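{- For all $n\geq1$, $$\Pi_n(12/3,\,123)=\{\sigma=B_1/B_2/\cdots/B_k\in\Pi_n:\ \min B_i=i \text{ for each } i,\ \text{and } k=n-1 \text{ or } k=n\},$$ and $\#\Pi_n(12/3,\,123)=n$.
   Context: For $n\ge 0$, $[n]=\{1,\dots,n\}$ and $\Pi_n$ is the set of set partitions of $[n]$. A partition is written $B_1/B_2/\cdots/B_k$ with blocks in canonical order $\min B_1<\cdots<\min B_k$ and elements of each block listed increasingly; e.g. $12/3=\{\{1,2\},\{3\}\}$. For $\pi\in\Pi_m$ and $\sigma\in\Pi_n$, $\sigma$ contains the pattern $\pi$ if there is $S\subseteq[n]$ with $\#S=m$ such that the restriction $\{B\cap S: B\in\sigma,\ B\cap S\neq\emptyset\}$, relabeled by the order-preserving bijection $S\to[m]$, equals $\pi$; otherwise $\sigma$ avoids $\pi$. For a set $R$ of patterns, $\Pi_n(R)$ is the set of $\sigma\in\Pi_n$ avoiding every pattern in $R$. -}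

module Defs where

open import Data.Nat using (ℕ; zero; suc; _<_; _≤_)
open import Data.Fin using (Fin; toℕ)
open import Data.List using (List; []; _∷_; map; upTo; concat; head; length; lookup)
open import Data.List.Membership.Propositional using (_∈_)
open import Data.List.Relation.Unary.All using (All)
open import Data.List.Relation.Unary.Linked using (Linked)
open import Data.List.Relation.Binary.Permutation.Propositional using (_↭_)
open import Data.Maybe using (Maybe; just)
open import Data.Product using (Σ; ∃; _×_)
open import Relation.Binary.PropositionalEquality using (_≡_; _≢_)
open import Relation.Nullary using (¬_)
open import Function.Bundles using (_⇔_)

-- A block is a list of elements of [n] listed increasingly;
-- a candidate partition is a list of blocks B₁/B₂/⋯/Bₖ.
Block : Set
Block = List ℕ

Partition : Set
Partition = List Block

range1 : ℕ → List ℕ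
range1 n = map suc (upTo n)

MinLess : Block → Block → Set
MinLess B C = ∀ b c → head B ≡ just b → head C ≡ just c → b < c

IsPartition : ℕ → Partition → Set
IsPartition n σ =
  All (λ B → B ≢ []) σ
  × All (Linked _<_) σ
  × Linked MinLess σ
  × (concat σ ↭ range1 n)

SameBlock : Partition → ℕ → ℕ → Set
SameBlock σ x y = Σ Block λ B → B ∈ σ × x ∈ B × y ∈ B

-- σ ∈ Π_n contains π ∈ Π_m: there is S = {s₁ < ⋯ < s_m} ⊆ [n] such that the
-- restriction of σ to S, relabelled by sᵢ ↦ i, equals π.  Two set partitions
-- of [m] are equal iff they have the same same-block relation, so this says:
-- i, j in the same block of π  ⇔  sᵢ, sⱼ in the same block of σ.
Contains : ℕ → Partition → (m : ℕ) → Partition → Set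
Contains n σ m π =
  Σ (Fin m → ℕ) λ s →
    (∀ i j → toℕ i < toℕ j → s i < s j)
    × (∀ i → 1 ≤ s i × s i ≤ n)
    × (∀ i j → SameBlock π (suc (toℕ i)) (suc (toℕ j)) ⇔ SameBlock σ (s i) (s j))

Avoids : ℕ → Partition → (m : ℕ) → Partition → Set
Avoids n σ m π = ¬ Contains n σ m π

p12/3 : Partition
p12/3 = (1 ∷ 2 ∷ []) ∷ (3 ∷ []) ∷ []

p123 : Partition
p123 = (1 ∷ 2 ∷ 3 ∷ []) ∷ []

InPiAvoid : ℕ → Partition → Set
InPiAvoid n σ = IsPartition n σ × Avoids n σ 3 p12/3 × Avoids n σ 3 p123

-- min Bᵢ = i for each i (blocks indexed from 1; Fin index i ↦ i+1)
MinsAreIndices : Partition → Set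
MinsAreIndices σ = ∀ (i : Fin (length σ)) → head (lookup σ i) ≡ just (suc (toℕ i))

{-# OPTIONS --safe #-}
-- If x < y lie in one block of σ ∈ Πₙ and y < n, then x, y, n is an occurrence of 123 or of
-- 12/3, according as n lies in that block or not; conversely, an occurrence of either pattern
-- puts two elements of one block below a third element, so the larger of the two is not n.
-- Hence σ avoids both patterns iff n is the only element that can fail to be the minimum of its
-- block, i.e. σ is 1/2/⋯/n or 1/⋯/{a, n}/⋯/(n−1) with a < n.  The block minima of such σ,
-- in order, are 1, 2, …, k with k ∈ {n − 1, n}; conversely such minima leave no room below n
-- for a non-minimal element.

module Submission where

open import Defs
open import Data.Bool using (if_then_else_; true; false)
open import Data.Empty using (⊥; ⊥-elim)
open import Data.Fin using (Fin; toℕ) renaming (zero to fzero; suc to fsuc)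
open import Data.List using (List; []; _∷_; [_]; _++_; _∷ʳ_; map; concat; length; head; lookup; applyUpTo)
open import Data.List.Properties using (length-map; map-upTo; ∷-injective; concat-map-[_])
open import Data.List.Membership.Propositional using (_∈_; _∉_)
open import Data.List.Membership.Propositional.Properties using (∈-map⁺; ∈-map⁻; ∈-++⁺ʳ; ∈-concat⁺′; ∈-concat⁻′)
open import Data.List.Relation.Unary.Any as Any using (here; there)
open import Data.List.Relation.Unary.All as All using (All; []; _∷_)
open import Data.List.Relation.Unary.All.Properties using () renaming (map⁺ to All-map⁺)
open import Data.List.Relation.Unary.AllPairs as AllPairs using ([]; _∷_)
open import Data.List.Relation.Unary.Linked as Linked using (Linked; []; [-]; _∷_)
open import Data.List.Relation.Unary.Linked.Properties using (Linked⇒AllPairs)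
open import Data.List.Relation.Unary.Unique.Propositional using (Unique)
open import Data.List.Relation.Binary.Permutation.Propositional using (_↭_; prep; ↭-sym; ↭-trans; ↭-reflexive; ↭⇒↭ₛ)
open import Data.List.Relation.Binary.Permutation.Propositional.Properties using (∈-resp-↭; ∷↭∷ʳ)
open import Data.Maybe using (just)
open import Data.Maybe.Properties using (just-injective)
open import Data.Nat using (ℕ; zero; suc; _+_; _∸_; _≤_; _<_; _≥_; _≡ᵇ_; z≤n; s≤s; z<s; _≟_; _≤?_)
open import Data.Nat.Properties
open import Data.List.Membership.DecPropositional _≟_ using (_∈?_)
open import Data.Product as Product using (Σ; ∃-syntax; _×_; _,_; proj₁; proj₂)
open import Data.Sum as Sum using (_⊎_; inj₁; inj₂)
open import Data.Unit using (tt)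
open import Function.Base using (_∘_)
open import Function.Bundles using (_⇔_; mk⇔; Equivalence)
open import Function.Properties.Equivalence using () renaming (sym to ⇔-sym; trans to ⇔-trans)
open import Relation.Binary.PropositionalEquality using (_≡_; _≢_; refl; sym; trans; cong; cong₂; subst; ≢-sym; setoid; module ≡-Reasoning)
open import Relation.Nullary using (¬_; Dec; yes; no; contradiction)
open import Data.List.Relation.Binary.Permutation.Setoid.Properties (setoid ℕ) using (Unique-resp-↭)

countFrom : ℕ → ℕ → List ℕ
countFrom s zero    = []
countFrom s (suc k) = s ∷ countFrom (suc s) k

length-countFrom : ∀ s k → length (countFrom s k) ≡ k
length-countFrom s zero    = refl
length-countFrom s (suc k) = cong suc (length-countFrom (suc s) k)

length-map-countFrom : ∀ {A : Set} (f : ℕ → A) s k → length (map f (countFrom s k)) ≡ k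
length-map-countFrom f s k = trans (length-map f (countFrom s k)) (length-countFrom s k)

∈-countFrom⁻ : ∀ {x} s k → x ∈ countFrom s k → s ≤ x × x < s + k
∈-countFrom⁻ s (suc k) (here refl) = ≤-refl , m<m+n s z<s
∈-countFrom⁻ {x} s (suc k) (there x∈) =
  let s<x , x<s+k = ∈-countFrom⁻ (suc s) k x∈ in <⇒≤ s<x , subst (x <_) (sym (+-suc s k)) x<s+k

∈-countFrom⁺ : ∀ {x} s k → s ≤ x → x < s + k → x ∈ countFrom s k
∈-countFrom⁺ {x} s zero    s≤x x<s+0 = contradiction (subst (x <_) (+-identityʳ s) x<s+0) (≤⇒≯ s≤x)
∈-countFrom⁺ {x} s (suc k) s≤x x<s+k with s ≟ x
... | yes refl = here refl
... | no s≢x   = there (∈-countFrom⁺ (suc s) k (≤∧≢⇒< s≤x s≢x) (subst (x <_) (+-suc s k) x<s+k))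

countFrom-∷ʳ : ∀ s k → countFrom s (suc k) ≡ countFrom s k ∷ʳ (s + k)
countFrom-∷ʳ s zero    = cong [_] (sym (+-identityʳ s))
countFrom-∷ʳ s (suc k) = cong (s ∷_) (trans (countFrom-∷ʳ (suc s) k) (cong (countFrom (suc s) k ∷ʳ_) (sym (+-suc s k))))

∈-countFrom-suc : ∀ {x} s k → x ∈ countFrom s k → x ∈ countFrom s (suc k)
∈-countFrom-suc s (suc k) (here refl) = here refl
∈-countFrom-suc s (suc k) (there x∈)  = there (∈-countFrom-suc (suc s) k x∈)

countFrom-unique : ∀ s k → Unique (countFrom s k)
countFrom-unique s zero    = []
countFrom-unique s (suc k) =
  All.tabulate (λ x∈ → <⇒≢ (proj₁ (∈-countFrom⁻ (suc s) k x∈))) ∷ countFrom-unique (suc s) k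

applyUpTo≡countFrom : ∀ {f : ℕ → ℕ} s k → (∀ i → f i ≡ s + i) → applyUpTo f k ≡ countFrom s k
applyUpTo≡countFrom s zero    f≗ = refl
applyUpTo≡countFrom s (suc k) f≗ =
  cong₂ _∷_ (trans (f≗ 0) (+-identityʳ s)) (applyUpTo≡countFrom (suc s) k (λ i → trans (f≗ (suc i)) (+-suc s i)))

range1≡countFrom : ∀ n → range1 n ≡ countFrom 1 n
range1≡countFrom n = trans (map-upTo suc n) (applyUpTo≡countFrom 1 n (λ _ → refl))

linked-head< : ∀ {h y t} → Linked _<_ (h ∷ t) → y ∈ t → h < y
linked-head< sorted = All.lookup (AllPairs.head (Linked⇒AllPairs <-trans sorted))

linked-head≤ : ∀ {h y t} → Linked _<_ (h ∷ t) → y ∈ h ∷ t → h ≤ y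
linked-head≤ sorted (here refl) = ≤-refl
linked-head≤ sorted (there y∈) = <⇒≤ (linked-head< sorted y∈)

nonMinimal∈tail : ∀ {h t x y} → Linked _<_ (h ∷ t) → x ∈ h ∷ t → y ∈ h ∷ t → x < y → y ∈ t
nonMinimal∈tail sorted x∈ y∈ x<y = Any.tail (>⇒≢ (≤-<-trans (linked-head≤ sorted x∈) x<y)) y∈

countFrom-sandwich : ∀ {s} k {xs} → Linked _<_ xs →
                     All (_∈ countFrom s (suc k)) xs → (∀ {y} → y ∈ countFrom s k → y ∈ xs) →
                     xs ≡ countFrom s k ⊎ xs ≡ countFrom s (suc k)
countFrom-sandwich zero    {[]}        _          _                          _      = inj₁ refl
countFrom-sandwich zero    {x ∷ []}    _          (here refl ∷ [])           _      = inj₂ refl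
countFrom-sandwich zero    {x ∷ _ ∷ _} (x<z ∷ _)  (here refl ∷ here refl ∷ _) _     = contradiction x<z (<-irrefl refl)
countFrom-sandwich (suc k) {[]}        _          _                          covers with () ← covers (here refl)
countFrom-sandwich (suc k) {x ∷ xs}    sorted     (there x∈ ∷ _)             covers =
  contradiction (linked-head≤ sorted (covers (here refl))) (<⇒≱ (proj₁ (∈-countFrom⁻ _ (suc k) x∈)))
countFrom-sandwich (suc k) {x ∷ xs}    sorted     (here refl ∷ below)        covers =
  Sum.map (cong (x ∷_)) (cong (x ∷_)) (countFrom-sandwich k (Linked.tail sorted) below′ covers′)
  where
  below′ : All (_∈ countFrom (suc x) (suc k)) xs
  below′ = All.tabulate (λ z∈ → Any.tail (>⇒≢ (linked-head< sorted z∈)) (All.lookup below z∈))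
  covers′ : ∀ {y} → y ∈ countFrom (suc x) k → y ∈ xs
  covers′ y∈ = Any.tail (>⇒≢ (proj₁ (∈-countFrom⁻ (suc x) k y∈))) (covers (there y∈))

++-unique⇒disjoint : ∀ {A : Set} (xs : List A) {ys x} → Unique (xs ++ ys) → x ∈ xs → x ∉ ys
++-unique⇒disjoint (a ∷ xs) (a∉ ∷ _) (here refl) x∈ys = All.lookup a∉ (∈-++⁺ʳ xs x∈ys) refl
++-unique⇒disjoint (a ∷ xs) (_ ∷ u)  (there x∈xs)    = ++-unique⇒disjoint xs u x∈xs

++-unique⇒uniqueʳ : ∀ {A : Set} (xs : List A) {ys} → Unique (xs ++ ys) → Unique ys
++-unique⇒uniqueʳ []       u       = u
++-unique⇒uniqueʳ (a ∷ xs) (_ ∷ u) = ++-unique⇒uniqueʳ xs u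

concat-unique⇒block-unique : ∀ {A : Set} (σ : List (List A)) {B B′ x} → Unique (concat σ) → B ∈ σ → B′ ∈ σ → x ∈ B → x ∈ B′ → B ≡ B′
concat-unique⇒block-unique (C ∷ σ) u (here refl) (here refl)  x∈C x∈C′ = refl
concat-unique⇒block-unique (C ∷ σ) u (here refl) (there B′∈) x∈C x∈B′ =
  contradiction (∈-concat⁺′ x∈B′ B′∈) (++-unique⇒disjoint C u x∈C)
concat-unique⇒block-unique (C ∷ σ) u (there B∈)  (here refl) x∈B x∈C =
  contradiction (∈-concat⁺′ x∈B B∈) (++-unique⇒disjoint C u x∈C)
concat-unique⇒block-unique (C ∷ σ) u (there B∈)  (there B′∈) x∈B x∈B′ =
  concat-unique⇒block-unique σ (++-unique⇒uniqueʳ C u) B∈ B′∈ x∈B x∈B′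

map-unique : ∀ {A B : Set} {f : A → B} {xs} → (∀ {a b} → a ∈ xs → b ∈ xs → f a ≡ f b → a ≡ b) → Unique xs → Unique (map f xs)
map-unique {xs = []}     _   []          = []
map-unique {xs = x ∷ xs} inj (x∉ ∷ uniq) =
  All-map⁺ (All.tabulate (λ b∈ fx≡fb → All.lookup x∉ b∈ (inj (here refl) (there b∈) fx≡fb)))
  ∷ map-unique (λ a∈ b∈ → inj (there a∈) (there b∈)) uniq

-- The value on the empty block is junk: blocks of a partition are nonempty.
blockMin : Block → ℕ
blockMin []      = 0
blockMin (x ∷ _) = x

blockMins : Partition → List ℕ
blockMins = map blockMin

head≡just⇒blockMin : ∀ {B x} → head B ≡ just x → blockMin B ≡ x
head≡just⇒blockMin {_ ∷ _} eq = just-injective eq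

-- MinsAreIndices is MinsFrom 1 by definition, as 1 + i reduces to suc i.
MinsFrom : ℕ → Partition → Set
MinsFrom s σ = ∀ (i : Fin (length σ)) → head (lookup σ i) ≡ just (s + toℕ i)

minsFrom⇒blockMins≡countFrom : ∀ s σ → MinsFrom s σ → blockMins σ ≡ countFrom s (length σ)
minsFrom⇒blockMins≡countFrom s []      mins = refl
minsFrom⇒blockMins≡countFrom s (B ∷ σ) mins =
  cong₂ _∷_ (head≡just⇒blockMin (trans (mins fzero) (cong just (+-identityʳ s))))
            (minsFrom⇒blockMins≡countFrom (suc s) σ (λ i → trans (mins (fsuc i)) (cong just (+-suc s (toℕ i)))))

blockMins≡countFrom⇒minsFrom : ∀ s σ {k} → All (_≢ []) σ → blockMins σ ≡ countFrom s k → MinsFrom s σ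
blockMins≡countFrom⇒minsFrom s ([] ∷ σ)      (B≢[] ∷ _) eq i = contradiction refl B≢[]
blockMins≡countFrom⇒minsFrom s ((h ∷ t) ∷ σ) {suc k} (_ ∷ ne) eq i with ∷-injective eq
... | refl , eq′ with i
...   | fzero  = cong just (sym (+-identityʳ s))
...   | fsuc i = trans (blockMins≡countFrom⇒minsFrom (suc s) σ ne eq′ i) (cong just (sym (+-suc s (toℕ i))))

≡map-blockMins : ∀ {f : ℕ → Block} σ → All (λ B → B ≡ f (blockMin B)) σ → σ ≡ map f (blockMins σ)
≡map-blockMins []      []          = refl
≡map-blockMins (B ∷ σ) (B≡ ∷ σ≡) = cong₂ _∷_ B≡ (≡map-blockMins σ σ≡)

blockMins-linked : ∀ {σ} → All (_≢ []) σ → Linked MinLess σ → Linked _<_ (blockMins σ)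
blockMins-linked {[]}                       _                 _           = []
blockMins-linked {_ ∷ []}                   _                 _           = [-]
blockMins-linked {[] ∷ _ ∷ _}               (B≢[] ∷ _)        _           = contradiction refl B≢[]
blockMins-linked {(_ ∷ _) ∷ [] ∷ _}         (_ ∷ C≢[] ∷ _)    _           = contradiction refl C≢[]
blockMins-linked {(_ ∷ _) ∷ (_ ∷ _) ∷ _}    (_ ∷ ne)          (B<C ∷ ml)  =
  B<C _ _ refl refl ∷ blockMins-linked ne ml

map-countFrom-minLess : ∀ (f : ℕ → Block) s k → (∀ x → head (f x) ≡ just x) → Linked MinLess (map f (countFrom s k))
map-countFrom-minLess f s zero          _      = []
map-countFrom-minLess f s (suc zero)    _      = [-]
map-countFrom-minLess f s (suc (suc k)) head≡ = s<1+s ∷ map-countFrom-minLess f (suc s) (suc k) head≡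
  where
  s<1+s : MinLess (f s) (f (suc s))
  s<1+s b c b≡ c≡ with just-injective (trans (sym b≡) (head≡ s)) | just-injective (trans (sym c≡) (head≡ (suc s)))
  ... | refl | refl = ≤-refl

module PartitionProperties {n : ℕ} {σ : Partition} (P : IsPartition n σ) where

  blocks-nonempty : All (_≢ []) σ
  blocks-nonempty = proj₁ P

  blocks-sorted : All (Linked _<_) σ
  blocks-sorted = proj₁ (proj₂ P)

  elements↭ : concat σ ↭ countFrom 1 n
  elements↭ = subst (concat σ ↭_) (range1≡countFrom n) (proj₂ (proj₂ (proj₂ P)))

  ∈concat⇔ : ∀ {x} → x ∈ concat σ ⇔ x ∈ countFrom 1 n
  ∈concat⇔ = mk⇔ (∈-resp-↭ elements↭) (∈-resp-↭ (↭-sym elements↭))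

  ∈concat⇒bounds : ∀ {x} → x ∈ concat σ → 1 ≤ x × x ≤ n
  ∈concat⇒bounds x∈ = let 1≤x , x<1+n = ∈-countFrom⁻ 1 n (Equivalence.to ∈concat⇔ x∈) in 1≤x , ≤-pred x<1+n

  ∈block⇒bounds : ∀ {B x} → B ∈ σ → x ∈ B → 1 ≤ x × x ≤ n
  ∈block⇒bounds B∈ x∈ = ∈concat⇒bounds (∈-concat⁺′ x∈ B∈)

  block-unique : ∀ {B B′ x} → B ∈ σ → B′ ∈ σ → x ∈ B → x ∈ B′ → B ≡ B′
  block-unique = concat-unique⇒block-unique σ (Unique-resp-↭ (↭⇒↭ₛ (↭-sym elements↭)) (countFrom-unique 1 n))

  blockMins-sorted : Linked _<_ (blockMins σ)
  blockMins-sorted = blockMins-linked blocks-nonempty (proj₁ (proj₂ (proj₂ P)))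

  ∈blockMins⇒ : ∀ {y} → y ∈ blockMins σ → ∃[ t ] (y ∷ t) ∈ σ
  ∈blockMins⇒ y∈ with ∈-map⁻ blockMin y∈
  ... | []      , B∈ , _    = contradiction refl (All.lookup blocks-nonempty B∈)
  ... | (y ∷ t) , B∈ , refl = t , B∈

  nonMinimal∉blockMins : ∀ {x y} → SameBlock σ x y → x < y → y ∉ blockMins σ
  nonMinimal∉blockMins ([] , _ , () , _)
  nonMinimal∉blockMins (h ∷ t , B∈ , x∈ , y∈) x<y y∈mins with ∈blockMins⇒ y∈mins
  ... | _ , B′∈ with refl ← block-unique B∈ B′∈ y∈ (here refl) =
    <-irrefl refl (linked-head< sorted (nonMinimal∈tail sorted x∈ y∈ x<y))
    where
    sorted : Linked _<_ (h ∷ t)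
    sorted = All.lookup blocks-sorted B∈

NonMinimalIsTop : ℕ → Partition → Set
NonMinimalIsTop n σ = ∀ {x y} → SameBlock σ x y → x < y → y ≡ n

tails-top⇒nonMinimalIsTop : ∀ {n σ} → All (Linked _<_) σ → (∀ {h t} → h ∷ t ∈ σ → All (_≡ n) t) → NonMinimalIsTop n σ
tails-top⇒nonMinimalIsTop sorted tails ([]    , _  , () , _)
tails-top⇒nonMinimalIsTop sorted tails (h ∷ t , B∈ , x∈ , y∈) x<y =
  All.lookup (tails B∈) (nonMinimal∈tail (All.lookup sorted B∈) x∈ y∈ x<y)

sameBlock-sym : ∀ {σ x y} → SameBlock σ x y → SameBlock σ y x
sameBlock-sym (B , B∈ , x∈ , y∈) = B , B∈ , y∈ , x∈

nonMinimalIsTop⇒avoids : ∀ {n σ π} → NonMinimalIsTop n σ → SameBlock π 1 2 → Avoids n σ 3 π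
nonMinimalIsTop⇒avoids top 1~2 (s , increasing , bounds , same)
  with top (Equivalence.to (same fzero (fsuc fzero)) 1~2) (increasing fzero (fsuc fzero) z<s)
... | refl = <⇒≱ (increasing (fsuc fzero) (fsuc (fsuc fzero)) (s≤s z<s)) (proj₂ (bounds (fsuc (fsuc fzero))))

triple : ℕ → ℕ → ℕ → Fin 3 → ℕ
triple x y z fzero               = x
triple x y z (fsuc fzero)        = y
triple x y z (fsuc (fsuc fzero)) = z

triple-increasing : ∀ {x y z} → x < y → y < z → ∀ i j → toℕ i < toℕ j → triple x y z i < triple x y z j
triple-increasing x<y y<z fzero               (fsuc fzero)        _ = x<y
triple-increasing x<y y<z fzero               (fsuc (fsuc fzero)) _ = <-trans x<y y<z
triple-increasing x<y y<z (fsuc fzero)        (fsuc (fsuc fzero)) _ = y<z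
triple-increasing x<y y<z fzero               fzero               ()
triple-increasing x<y y<z (fsuc fzero)        fzero               ()
triple-increasing x<y y<z (fsuc fzero)        (fsuc fzero)        (s≤s ())
triple-increasing x<y y<z (fsuc (fsuc fzero)) fzero               ()
triple-increasing x<y y<z (fsuc (fsuc fzero)) (fsuc fzero)        (s≤s ())
triple-increasing x<y y<z (fsuc (fsuc fzero)) (fsuc (fsuc fzero)) (s≤s (s≤s ()))

sameBlock-12/3-with3 : ∀ {a} → SameBlock p12/3 a 3 → a ≡ 3
sameBlock-12/3-with3 (_ , here refl , _ , here ())
sameBlock-12/3-with3 (_ , here refl , _ , there (here ()))
sameBlock-12/3-with3 (_ , here refl , _ , there (there ()))
sameBlock-12/3-with3 (_ , there (here refl) , here refl , _) = refl
sameBlock-12/3-with3 (_ , there (here refl) , there () , _)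

module _ {n σ} (P : IsPartition n σ) {B x y z} (B∈ : B ∈ σ) (x∈ : x ∈ B) (y∈ : y ∈ B)
         (x<y : x < y) (y<z : y < z) (z∈ : z ∈ concat σ) where
  open PartitionProperties P

  private
    t : Fin 3 → ℕ
    t = triple x y z

    x≥1 : 1 ≤ x
    x≥1 = proj₁ (∈block⇒bounds B∈ x∈)

    n≥z : n ≥ z
    n≥z = proj₂ (∈concat⇒bounds z∈)

    bounds : ∀ i → 1 ≤ t i × t i ≤ n
    bounds fzero               = x≥1 , ≤-trans (<⇒≤ (<-trans x<y y<z)) n≥z
    bounds (fsuc fzero)        = ≤-trans x≥1 (<⇒≤ x<y) , ≤-trans (<⇒≤ y<z) n≥z
    bounds (fsuc (fsuc fzero)) = ≤-trans x≥1 (<⇒≤ (<-trans x<y y<z)) , n≥z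

  contains123 : z ∈ B → Contains n σ 3 p123
  contains123 z∈B = t , triple-increasing x<y y<z , bounds , λ i j →
      mk⇔ (λ _ → B , B∈ , ∈B i , ∈B j) (λ _ → _ , here refl , ∈123 i , ∈123 j)
    where
    ∈B : ∀ i → t i ∈ B
    ∈B fzero               = x∈
    ∈B (fsuc fzero)        = y∈
    ∈B (fsuc (fsuc fzero)) = z∈B
    ∈123 : ∀ (i : Fin 3) → suc (toℕ i) ∈ 1 ∷ 2 ∷ 3 ∷ []
    ∈123 fzero               = here refl
    ∈123 (fsuc fzero)        = there (here refl)
    ∈123 (fsuc (fsuc fzero)) = there (there (here refl))

  contains12/3 : z ∉ B → Contains n σ 3 p12/3
  contains12/3 z∉B = t , triple-increasing x<y y<z , bounds , same
    where
    both : ∀ {a b c d} → SameBlock p12/3 a b → SameBlock σ c d → SameBlock p12/3 a b ⇔ SameBlock σ c d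
    both p q = mk⇔ (λ _ → q) (λ _ → p)
    neither : ∀ {a b c d} → ¬ SameBlock p12/3 a b → ¬ SameBlock σ c d → SameBlock p12/3 a b ⇔ SameBlock σ c d
    neither ¬p ¬q = mk⇔ (λ p → contradiction p ¬p) (λ q → contradiction q ¬q)
    ¬with3 : ∀ {a} → a ≢ 3 → ¬ SameBlock p12/3 a 3
    ¬with3 a≢3 p = a≢3 (sameBlock-12/3-with3 p)
    ¬withZ : ∀ {w} → w ∈ B → ¬ SameBlock σ w z
    ¬withZ w∈B (B′ , B′∈ , w∈B′ , z∈B′) with block-unique B∈ B′∈ w∈B w∈B′
    ... | refl = z∉B z∈B′
    z~z : SameBlock σ z z
    z~z = let C , z∈C , C∈ = ∈-concat⁻′ σ z∈ in C , C∈ , z∈C , z∈C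
    1~2 : SameBlock p12/3 1 2
    1~2 = _ , here refl , here refl , there (here refl)
    same : ∀ i j → SameBlock p12/3 (suc (toℕ i)) (suc (toℕ j)) ⇔ SameBlock σ (t i) (t j)
    same fzero               fzero               = both (_ , here refl , here refl , here refl) (B , B∈ , x∈ , x∈)
    same fzero               (fsuc fzero)        = both 1~2 (B , B∈ , x∈ , y∈)
    same (fsuc fzero)        fzero               = both (sameBlock-sym 1~2) (B , B∈ , y∈ , x∈)
    same (fsuc fzero)        (fsuc fzero)        = both (_ , here refl , there (here refl) , there (here refl)) (B , B∈ , y∈ , y∈)
    same fzero               (fsuc (fsuc fzero)) = neither (¬with3 (λ ())) (¬withZ x∈)
    same (fsuc fzero)        (fsuc (fsuc fzero)) = neither (¬with3 (λ ())) (¬withZ y∈)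
    same (fsuc (fsuc fzero)) fzero               = neither (¬with3 (λ ()) ∘ sameBlock-sym) (¬withZ x∈ ∘ sameBlock-sym)
    same (fsuc (fsuc fzero)) (fsuc fzero)        = neither (¬with3 (λ ()) ∘ sameBlock-sym) (¬withZ y∈ ∘ sameBlock-sym)
    same (fsuc (fsuc fzero)) (fsuc (fsuc fzero)) = both (_ , there (here refl) , here refl , here refl) z~z

avoids⇒nonMinimalIsTop : ∀ {n σ} → IsPartition n σ → Avoids n σ 3 p12/3 → Avoids n σ 3 p123 → NonMinimalIsTop n σ
avoids⇒nonMinimalIsTop {n} {σ} P avoid12/3 avoid123 {x} {y} (B , B∈ , x∈ , y∈) x<y with y ≟ n
... | yes y≡n = y≡n
... | no y≢n  = ⊥-elim (realise (n ∈? B))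
  where
  open PartitionProperties P
  y-bounds : 1 ≤ y × y ≤ n
  y-bounds = ∈block⇒bounds B∈ y∈
  y<n : y < n
  y<n = ≤∧≢⇒< (proj₂ y-bounds) y≢n
  n∈σ : n ∈ concat σ
  n∈σ = Equivalence.from ∈concat⇔ (∈-countFrom⁺ 1 n (≤-trans (proj₁ y-bounds) (<⇒≤ y<n)) ≤-refl)
  realise : Dec (n ∈ B) → ⊥
  realise (yes n∈B) = avoid123 (contains123 P B∈ x∈ y∈ x<y y<n n∈σ n∈B)
  realise (no n∉B)  = avoid12/3 (contains12/3 P B∈ x∈ y∈ x<y y<n n∈σ n∉B)

inPiAvoid⇔nonMinimalIsTop : ∀ {n σ} → InPiAvoid n σ ⇔ (IsPartition n σ × NonMinimalIsTop n σ)
inPiAvoid⇔nonMinimalIsTop = mk⇔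
  (λ (P , avoid12/3 , avoid123) → P , avoids⇒nonMinimalIsTop P avoid12/3 avoid123)
  (λ (P , top) → P , nonMinimalIsTop⇒avoids top 1~2 , nonMinimalIsTop⇒avoids top 1~2)
  where
  1~2 : ∀ {B π} → SameBlock ((1 ∷ 2 ∷ B) ∷ π) 1 2
  1~2 = _ , here refl , here refl , there (here refl)

module _ {m σ} (P : IsPartition (suc m) σ) where
  open PartitionProperties P

  nonMinimalIsTop⇒blockMins : NonMinimalIsTop (suc m) σ → blockMins σ ≡ countFrom 1 m ⊎ blockMins σ ≡ countFrom 1 (suc m)
  nonMinimalIsTop⇒blockMins top = countFrom-sandwich m blockMins-sorted (All.tabulate min∈) covered
    where
    min∈ : ∀ {y} → y ∈ blockMins σ → y ∈ countFrom 1 (suc m)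
    min∈ y∈ = let _ , B∈ = ∈blockMins⇒ y∈ in Equivalence.to ∈concat⇔ (∈-concat⁺′ (here refl) B∈)
    covered : ∀ {y} → y ∈ countFrom 1 m → y ∈ blockMins σ
    covered y∈ with ∈-concat⁻′ σ (Equivalence.from ∈concat⇔ (∈-countFrom-suc 1 m y∈))
    ... | h ∷ t , here refl , B∈ = ∈-map⁺ blockMin B∈
    ... | h ∷ t , there y∈t , B∈ =
      contradiction (top (h ∷ t , B∈ , here refl , there y∈t) (linked-head< (All.lookup blocks-sorted B∈) y∈t))
                    (<⇒≢ (proj₂ (∈-countFrom⁻ 1 m y∈)))

  blockMins⇒nonMinimalIsTop : ∀ {k} → m ≤ k → blockMins σ ≡ countFrom 1 k → NonMinimalIsTop (suc m) σ
  blockMins⇒nonMinimalIsTop {k} m≤k mins≡ {x} {y} x~y@(B , B∈ , _ , y∈) x<y with y ≤? m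
  ... | yes y≤m = contradiction (subst (y ∈_) (sym mins≡) (∈-countFrom⁺ 1 k 1≤y (s≤s (≤-trans y≤m m≤k))))
                                (nonMinimal∉blockMins x~y x<y)
    where
    1≤y : 1 ≤ y
    1≤y = proj₁ (∈block⇒bounds B∈ y∈)
  ... | no y≰m  = ≤-antisym (proj₂ (∈block⇒bounds B∈ y∈)) (≰⇒> y≰m)

  nonMinimalIsTop⇔minsAreIndices : NonMinimalIsTop (suc m) σ ⇔ (MinsAreIndices σ × (length σ ≡ m ⊎ length σ ≡ suc m))
  nonMinimalIsTop⇔minsAreIndices = mk⇔ to from
    where
    shape : ∀ {k} → blockMins σ ≡ countFrom 1 k → MinsAreIndices σ × length σ ≡ k
    shape {k} mins≡ = blockMins≡countFrom⇒minsFrom 1 σ blocks-nonempty mins≡ , (begin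
      length σ                ≡⟨ length-map blockMin σ ⟨
      length (blockMins σ)    ≡⟨ cong length mins≡ ⟩
      length (countFrom 1 k)  ≡⟨ length-countFrom 1 k ⟩
      k                       ∎)
      where open ≡-Reasoning
    to : NonMinimalIsTop (suc m) σ → MinsAreIndices σ × (length σ ≡ m ⊎ length σ ≡ suc m)
    to top = Sum.[ Product.map₂ inj₁ ∘ shape , Product.map₂ inj₂ ∘ shape ] (nonMinimalIsTop⇒blockMins top)
    from : MinsAreIndices σ × (length σ ≡ m ⊎ length σ ≡ suc m) → NonMinimalIsTop (suc m) σ
    from (mins , length≡) = blockMins⇒nonMinimalIsTop m≤length (minsFrom⇒blockMins≡countFrom 1 σ mins)
      where
      m≤length : m ≤ length σ
      m≤length = Sum.[ ≤-reflexive ∘ sym , (λ e → subst (m ≤_) (sym e) (n≤1+n m)) ] length≡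

attachTop : ℕ → ℕ → ℕ → Block
attachTop n a x = x ∷ (if x ≡ᵇ a then [ n ] else [])

attachTop-≡ : ∀ n a → attachTop n a a ≡ a ∷ [ n ]
attachTop-≡ n a with a ≡ᵇ a | ≡⇒≡ᵇ a a refl
... | true | _ = refl

attachTop-≢ : ∀ n a x → x ≢ a → attachTop n a x ≡ [ x ]
attachTop-≢ n a x x≢a with x ≡ᵇ a | ≡ᵇ⇒≡ x a
... | true  | x≡a = contradiction (x≡a tt) x≢a
... | false | _   = refl

concat-attachTop-∉ : ∀ n a xs → a ∉ xs → concat (map (attachTop n a) xs) ≡ xs
concat-attachTop-∉ n a []       _   = refl
concat-attachTop-∉ n a (x ∷ xs) a∉ =
  cong₂ _++_ (attachTop-≢ n a x (λ x≡a → a∉ (here (sym x≡a)))) (concat-attachTop-∉ n a xs (a∉ ∘ there))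

concat-attachTop : ∀ n a xs → a ∈ xs → Unique xs → concat (map (attachTop n a) xs) ↭ xs ∷ʳ n
concat-attachTop n a (x ∷ xs) a∈ (x∉ ∷ uniq) with x ≟ a
... | yes refl = ↭-trans (↭-reflexive (cong₂ _++_ (attachTop-≡ n x) (concat-attachTop-∉ n x xs x∉xs))) (prep x (∷↭∷ʳ n xs))
  where
  x∉xs : x ∉ xs
  x∉xs x∈ = All.lookup x∉ x∈ refl
... | no x≢a   = ↭-trans (↭-reflexive (cong (_++ concat (map (attachTop n a) xs)) (attachTop-≢ n a x x≢a)))
                         (prep x (concat-attachTop n a xs (Any.tail (≢-sym x≢a) a∈) uniq))

singletons : ℕ → Partition
singletons n = map [_] (countFrom 1 n)

-- 1/2/⋯/{a, m+1}/⋯/m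
joinedToTop : ℕ → ℕ → Partition
joinedToTop m a = map (attachTop (suc m) a) (countFrom 1 m)

avoiders : ℕ → List Partition
avoiders m = singletons (suc m) ∷ map (joinedToTop m) (countFrom 1 m)

singletons-isPartition : ∀ n → IsPartition n (singletons n)
singletons-isPartition n =
  All-map⁺ (All.universal (λ _ ()) (countFrom 1 n)) ,
  All-map⁺ (All.universal (λ _ → [-]) (countFrom 1 n)) ,
  map-countFrom-minLess [_] 1 n (λ _ → refl) ,
  ↭-reflexive (trans concat-map-[ countFrom 1 n ] (sym (range1≡countFrom n)))

singletons-nonMinimalIsTop : ∀ n → NonMinimalIsTop n (singletons n)
singletons-nonMinimalIsTop n = tails-top⇒nonMinimalIsTop (proj₁ (proj₂ (singletons-isPartition n))) tails
  where
  tails : ∀ {h t} → h ∷ t ∈ singletons n → All (_≡ n) t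
  tails B∈ with ∈-map⁻ [_] B∈
  ... | _ , _ , refl = []

module _ m {a} (a∈ : a ∈ countFrom 1 m) where

  joinedToTop-isPartition : IsPartition (suc m) (joinedToTop m a)
  joinedToTop-isPartition =
    All-map⁺ (All.universal (λ _ ()) (countFrom 1 m)) ,
    All-map⁺ (All.tabulate sorted) ,
    map-countFrom-minLess (attachTop (suc m) a) 1 m (λ _ → refl) ,
    subst (concat (joinedToTop m a) ↭_) (trans (sym (countFrom-∷ʳ 1 m)) (sym (range1≡countFrom (suc m))))
          (concat-attachTop (suc m) a (countFrom 1 m) a∈ (countFrom-unique 1 m))
    where
    sorted : ∀ {x} → x ∈ countFrom 1 m → Linked _<_ (attachTop (suc m) a x)
    sorted {x} x∈ with x ≡ᵇ a
    ... | true  = proj₂ (∈-countFrom⁻ 1 m x∈) ∷ [-]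
    ... | false = [-]

  joinedToTop-nonMinimalIsTop : NonMinimalIsTop (suc m) (joinedToTop m a)
  joinedToTop-nonMinimalIsTop = tails-top⇒nonMinimalIsTop (proj₁ (proj₂ joinedToTop-isPartition)) tails
    where
    tails : ∀ {h t} → h ∷ t ∈ joinedToTop m a → All (_≡ suc m) t
    tails B∈ with ∈-map⁻ (attachTop (suc m) a) B∈
    ... | x , _ , refl with x ≡ᵇ a
    ...   | true  = refl ∷ []
    ...   | false = []

module _ {m σ} (P : IsPartition (suc m) σ) (top : NonMinimalIsTop (suc m) σ) where
  open PartitionProperties P

  top∈countFrom : suc m ∈ countFrom 1 (suc m)
  top∈countFrom = ∈-countFrom⁺ 1 (suc m) (s≤s z≤n) ≤-refl

  blockShape : ∀ {B} → B ∈ σ → ∃[ h ] (B ≡ [ h ] ⊎ B ≡ h ∷ [ suc m ])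
  blockShape {[]}            B∈ = contradiction refl (All.lookup blocks-nonempty B∈)
  blockShape {h ∷ []}        B∈ = h , inj₁ refl
  blockShape {h ∷ y ∷ []}    B∈
    with refl ← top (_ , B∈ , here refl , there (here refl)) (Linked.head (All.lookup blocks-sorted B∈)) = h , inj₂ refl
  blockShape {h ∷ y ∷ z ∷ t} B∈ = contradiction y<z (<-irrefl (trans y≡top (sym z≡top)))
    where
    sorted : Linked _<_ (h ∷ y ∷ z ∷ t)
    sorted = All.lookup blocks-sorted B∈
    h<y : h < y
    h<y = Linked.head sorted
    y<z : y < z
    y<z = Linked.head (Linked.tail sorted)
    y≡top : y ≡ suc m
    y≡top = top (_ , B∈ , here refl , there (here refl)) h<y
    z≡top : z ≡ suc m
    z≡top = top (_ , B∈ , here refl , there (there (here refl))) (<-trans h<y y<z)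

  allMinimal⇒singletons : blockMins σ ≡ countFrom 1 (suc m) → σ ≡ singletons (suc m)
  allMinimal⇒singletons mins≡ = trans (≡map-blockMins σ (All.tabulate singleton)) (cong (map [_]) mins≡)
    where
    singleton : ∀ {B} → B ∈ σ → B ≡ [ blockMin B ]
    singleton B∈ with blockShape B∈
    ... | h , inj₁ refl = refl
    ... | h , inj₂ refl = contradiction (subst (suc m ∈_) (sym mins≡) top∈countFrom)
                                        (nonMinimal∉blockMins (_ , B∈ , here refl , there (here refl)) (Linked.head (All.lookup blocks-sorted B∈)))

  topJoined⇒joinedToTop : blockMins σ ≡ countFrom 1 m → ∃[ a ] (a ∈ countFrom 1 m × σ ≡ joinedToTop m a)
  topJoined⇒joinedToTop mins≡ with ∈-concat⁻′ σ (Equivalence.from ∈concat⇔ top∈countFrom)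
  ... | B , top∈B , B∈ with blockShape B∈
  ...   | h , inj₁ refl with here refl ← top∈B =
    contradiction (proj₂ (∈-countFrom⁻ 1 m (subst (suc m ∈_) mins≡ (∈-map⁺ blockMin B∈)))) (<-irrefl refl)
  ...   | a , inj₂ refl =
    a , subst (a ∈_) mins≡ (∈-map⁺ blockMin B∈) ,
    trans (≡map-blockMins σ (All.tabulate attached)) (cong (map (attachTop (suc m) a)) mins≡)
    where
    attached : ∀ {B′} → B′ ∈ σ → B′ ≡ attachTop (suc m) a (blockMin B′)
    attached B′∈ with blockShape B′∈
    ... | h , inj₁ refl = sym (attachTop-≢ (suc m) a h h≢a)
      where
      h≢a : h ≢ a
      h≢a refl with () ← block-unique B′∈ B∈ (here refl) (here refl)
    ... | h , inj₂ refl with refl ← block-unique B′∈ B∈ (there (here refl)) (there (here refl)) = sym (attachTop-≡ (suc m) a)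

∈avoiders⇔ : ∀ {m σ} → σ ∈ avoiders m ⇔ (IsPartition (suc m) σ × NonMinimalIsTop (suc m) σ)
∈avoiders⇔ {m} {σ} = mk⇔ to from
  where
  to : σ ∈ avoiders m → IsPartition (suc m) σ × NonMinimalIsTop (suc m) σ
  to (here refl) = singletons-isPartition (suc m) , singletons-nonMinimalIsTop (suc m)
  to (there σ∈) with ∈-map⁻ (joinedToTop m) σ∈
  ... | a , a∈ , refl = joinedToTop-isPartition m a∈ , joinedToTop-nonMinimalIsTop m a∈
  from : IsPartition (suc m) σ × NonMinimalIsTop (suc m) σ → σ ∈ avoiders m
  from (P , top) with nonMinimalIsTop⇒blockMins P top
  ... | inj₂ mins≡ = here (allMinimal⇒singletons P top mins≡)
  ... | inj₁ mins≡ with a , a∈ , refl ← topJoined⇒joinedToTop P top mins≡ = there (∈-map⁺ (joinedToTop m) a∈)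

joinedToTop-injective : ∀ m {a b} → a ∈ countFrom 1 m → joinedToTop m a ≡ joinedToTop m b → a ≡ b
joinedToTop-injective m {a} {b} a∈ eq with ∈-map⁻ (attachTop (suc m) b) (subst (a ∷ [ suc m ] ∈_) eq pair∈)
  where
  pair∈ : a ∷ [ suc m ] ∈ joinedToTop m a
  pair∈ = subst (_∈ joinedToTop m a) (attachTop-≡ (suc m) a) (∈-map⁺ (attachTop (suc m) a) a∈)
... | x , _ , pair≡ with refl , tail≡ ← ∷-injective pair≡ with a ≡ᵇ b | ≡ᵇ⇒≡ a b
...   | true  | a≡b = a≡b tt
...   | false | _   = contradiction tail≡ λ ()

avoiders-unique : ∀ m → Unique (avoiders m)
avoiders-unique m =
  All-map⁺ (All.universal (λ a eq → contradiction (cong length eq) (length-differs a)) (countFrom 1 m))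
  ∷ map-unique (λ a∈ _ → joinedToTop-injective m a∈) (countFrom-unique 1 m)
  where
  length-differs : ∀ a → length (singletons (suc m)) ≢ length (joinedToTop m a)
  length-differs a eq =
    1+n≢n (trans (sym (length-map-countFrom [_] 1 (suc m))) (trans eq (length-map-countFrom (attachTop (suc m) a) 1 m)))

length-avoiders : ∀ m → length (avoiders m) ≡ suc m
length-avoiders m = cong suc (length-map-countFrom (joinedToTop m) 1 m)

proposition2p9 : (n : ℕ) → 1 ≤ n →
    ((σ : Partition) →
      InPiAvoid n σ ⇔
        (IsPartition n σ × MinsAreIndices σ × (length σ ≡ n ∸ 1 ⊎ length σ ≡ n)))
    × Σ (List Partition) (λ L →
        Unique L × ((σ : Partition) → σ ∈ L ⇔ InPiAvoid n σ) × length L ≡ n)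
proposition2p9 (suc m) _ = characterisation , avoiders m , avoiders-unique m , membership , length-avoiders m
  where
  characterisation : ∀ σ → InPiAvoid (suc m) σ ⇔ (IsPartition (suc m) σ × MinsAreIndices σ × (length σ ≡ m ⊎ length σ ≡ suc m))
  characterisation σ = mk⇔
    (λ avoid → let P , top = Equivalence.to inPiAvoid⇔nonMinimalIsTop avoid in P , Equivalence.to (nonMinimalIsTop⇔minsAreIndices P) top)
    (λ (P , shape) → Equivalence.from inPiAvoid⇔nonMinimalIsTop (P , Equivalence.from (nonMinimalIsTop⇔minsAreIndices P) shape))

  membership : ∀ σ → σ ∈ avoiders m ⇔ InPiAvoid (suc m) σ
  membership _ = ⇔-trans ∈avoiders⇔ (⇔-sym inPiAvoid⇔nonMinimalIsTop)
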